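{- For every integer $k>1$ there exists a connected finite simple graph $G$ such that the graph $I_{\alpha(G)}(G)$ has exactly $k$ vertices.
   Context: For a simple graph $G=(V,E)$, a set $I\subseteq V$ is independent if no two of its vertices are adjacent; the empty set is independent. $\alpha(G)$ denotes the maximum cardinality of an independent set. For a non-negative integer $k$, the $k$-independent graph $I_k(G)$ is the graph whose vertices are the independent sets of $G$ (including $\emptyset$) of cardinality at most $k$, two such sets being adjacent if and only if one is obtained from the other by adding or deleting a single vertex of $G$. In particular the vertices of $I_{\alpha(G)}(G)$ are all independent sets of $G$. -}

module Defs where

open import Data.Nat using (ℕ; zero; suc; _≤_; _⊔_)
open import Data.Bool using (Bool; true; false; _∧_; not; T)
open import Data.Fin using (Fin)
open import Data.Vec using (Vec; []; _∷_)
open import Data.List using (List; []; _∷_; map; _++_; filter; length; foldr; allFin)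
open import Data.List.Membership.Propositional using (_∈_)
open import Data.Fin.Subset using (Subset; inside; outside; ∣_∣)
open import Data.Fin.Subset.Properties using (_∈?_)
open import Data.Nat.Properties using (_≤?_)
open import Relation.Binary.PropositionalEquality using (_≡_)
open import Relation.Nullary.Decidable using (⌊_⌋)
open import Data.Product using (_×_)

record SimpleGraph (n : ℕ) : Set where
  field
    adj     : Fin n → Fin n → Bool
    sym     : ∀ u v → adj u v ≡ adj v u
    irrefl  : ∀ v → adj v v ≡ false
open SimpleGraph public

data Walk {n : ℕ} (G : SimpleGraph n) : Fin n → Fin n → Set where
  here : ∀ {v} → Walk G v v
  step : ∀ {u w v} → T (adj G u w) → Walk G w v → Walk G u v

Connected : ∀ {n} → SimpleGraph n → Set
Connected {n} G = (1 ≤ n) × (∀ u v → Walk G u v)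

allSubsets : ∀ n → List (Subset n)
allSubsets zero    = [] ∷ []
allSubsets (suc n) = map (inside ∷_) (allSubsets n) ++ map (outside ∷_) (allSubsets n)

isIndependent : ∀ {n} → SimpleGraph n → Subset n → Bool
isIndependent {n} G S =
  foldr _∧_ true (map (λ u → foldr _∧_ true (map (λ v →
     not (⌊ u ∈? S ⌋ ∧ ⌊ v ∈? S ⌋ ∧ adj G u v)) (allFin n))) (allFin n))

independentSets : ∀ {n} → SimpleGraph n → List (Subset n)
independentSets {n} G = filter (λ S → T? (isIndependent G S)) (allSubsets n)
  where
  open import Relation.Nullary using (Dec; yes; no)
  open import Data.Bool.Properties using (T?)

α : ∀ {n} → SimpleGraph n → ℕ
α G = foldr _⊔_ 0 (map ∣_∣ (independentSets G))

-- Vertices of the k-independent graph I_k(G): independent sets of size ≤ k.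
IkVertices : ∀ {n} → ℕ → SimpleGraph n → List (Subset n)
IkVertices k G = filter (λ S → ∣ S ∣ ≤? k) (independentSets G)

-- For every graph G, each independent set has at most α(G) elements, so the
-- vertices of I_α(G)(G) are all the independent sets of G. The complete graph
-- K_n (n ≥ 1) is connected and its independent sets are the empty set and the
-- n singletons, so I_α(K_n)(K_n) has n + 1 vertices; take n = k − 1.
module Submission where

open import Defs
open import Data.Nat using (ℕ; zero; suc; _+_; _<_; _≤_; _⊔_; s≤s; z≤n)
open import Data.Nat.Properties using (_≤?_; ≤-reflexive; m≤n⇒m≤n⊔o; m≤n⇒m≤o⊔n)
open import Data.Bool using (Bool; true; false; not; _∧_; T)
open import Data.Bool.Properties using (T?)
open import Data.Fin using (Fin; zero; suc; _≟_)
open import Data.Fin.Properties using (suc-injective; 0≢1+n)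
open import Data.Fin.Subset using (Subset; inside; outside; _∈_; ∣_∣; Empty)
open import Data.Fin.Subset.Properties using (_∈?_)
open import Data.Vec using ([]; _∷_; here; there)
open import Data.List using (List; []; _∷_; _++_; length; map; filter; foldr; allFin)
open import Data.Bool.ListAction using (all)
open import Data.List.Properties using (length-++; length-map; filter-++; filter-all; filter-≐; foldr-preservesᵒ)
open import Data.List.Membership.Propositional using () renaming (_∈_ to _∈ₗ_)
open import Data.List.Membership.Propositional.Properties using (∈-allFin; ∈-map⁺)
import Data.List.Relation.Unary.All as All
open import Data.List.Relation.Unary.All.Properties using (all⁺; all⁻)
import Data.List.Relation.Unary.Any as Any
open import Data.Product using (Σ; _×_; _,_)
open import Data.Sum using ([_,_]; inj₂)
open import Function using (_∘_; _⇔_; mk⇔; Equivalence)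
import Function.Properties.Equivalence as ⇔
open import Relation.Binary.PropositionalEquality
  using (_≡_; _≢_; refl; trans; cong; cong₂; subst; module ≡-Reasoning) renaming (sym to ≡-sym)
open import Relation.Nullary using (¬_; yes; no; does; contradiction)
open import Relation.Nullary.Decidable using (⌊_⌋; dec-true; dec-false; decidable-stable)
open import Relation.Unary using (Pred; Decidable)

private
  variable
    A B : Set
    n : ℕ

filter-map : ∀ {p} {P : Pred B p} (P? : Decidable P) (f : A → B) (xs : List A) →
             filter P? (map f xs) ≡ map f (filter (P? ∘ f) xs)
filter-map P? f [] = refl
filter-map P? f (x ∷ xs) with P? (f x)
... | yes _ = cong (f x ∷_) (filter-map P? f xs)
... | no  _ = filter-map P? f xs

∈⇒≤foldr-⊔ : ∀ {x xs} → x ∈ₗ xs → x ≤ foldr _⊔_ 0 xs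
∈⇒≤foldr-⊔ {xs = xs} x∈xs =
  foldr-preservesᵒ (λ a b → [ m≤n⇒m≤n⊔o b , m≤n⇒m≤o⊔n a ]) 0 xs
                   (inj₂ (Any.map ≤-reflexive x∈xs))

¬adjacent-self : (G : SimpleGraph n) (v : Fin n) → ¬ T (adj G v v)
¬adjacent-self G v = subst T (irrefl G v)

Independent : SimpleGraph n → Subset n → Set
Independent G S = ∀ {u v} → u ∈ S → v ∈ S → ¬ T (adj G u v)

T-isIndependent⇔Independent : (G : SimpleGraph n) (S : Subset n) →
                              T (isIndependent G S) ⇔ Independent G S
T-isIndependent⇔Independent {n} G S = mk⇔ to from
  where
  pair-ok : Fin n → Fin n → Bool
  pair-ok u v = not (⌊ u ∈? S ⌋ ∧ ⌊ v ∈? S ⌋ ∧ adj G u v)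

  pair-ok⇔ : ∀ u v → T (pair-ok u v) ⇔ (u ∈ S → v ∈ S → ¬ T (adj G u v))
  pair-ok⇔ u v with u ∈? S | v ∈? S | adj G u v
  ... | yes u∈ | yes v∈ | true  = mk⇔ (λ ()) (λ f → f u∈ v∈ _)
  ... | yes _  | yes _  | false = mk⇔ (λ _ _ _ ()) (λ _ → _)
  ... | yes _  | no v∉  | _     = mk⇔ (λ _ _ v∈ → contradiction v∈ v∉) (λ _ → _)
  ... | no u∉  | _      | _     = mk⇔ (λ _ u∈ → contradiction u∈ u∉) (λ _ → _)

  row-ok : Fin n → Bool
  row-ok u = all (pair-ok u) (allFin n)

  to : T (isIndependent G S) → Independent G S
  to t {u} {v} = Equivalence.to (pair-ok⇔ u v)
    (All.lookup (all⁺ (pair-ok u) (allFin n) (All.lookup (all⁺ row-ok (allFin n) t) (∈-allFin u)))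
                (∈-allFin v))

  from : Independent G S → T (isIndependent G S)
  from ind = all⁻ row-ok {xs = allFin n} (All.tabulate λ {u} _ →
    all⁻ (pair-ok u) {xs = allFin n} (All.tabulate λ {v} _ → Equivalence.from (pair-ok⇔ u v) ind))

∣∣≤α : (G : SimpleGraph n) {S : Subset n} → S ∈ₗ independentSets G → ∣ S ∣ ≤ α G
∣∣≤α G S∈ = ∈⇒≤foldr-⊔ (∈-map⁺ ∣_∣ S∈)

IkVertices-α≡independentSets : (G : SimpleGraph n) → IkVertices (α G) G ≡ independentSets G
IkVertices-α≡independentSets G = filter-all (λ S → ∣ S ∣ ≤? α G) (All.tabulate (∣∣≤α G))

#subsets : (Subset n → Bool) → ℕ
#subsets {n} p = length (filter (T? ∘ p) (allSubsets n))

#subsets-suc : (p : Subset (suc n) → Bool) →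
               #subsets p ≡ #subsets (p ∘ (inside ∷_)) + #subsets (p ∘ (outside ∷_))
#subsets-suc {n} p = begin
  length (filter P? (map (inside ∷_) xs ++ map (outside ∷_) xs))
    ≡⟨ cong length (filter-++ P? (map (inside ∷_) xs) _) ⟩
  length (filter P? (map (inside ∷_) xs) ++ filter P? (map (outside ∷_) xs))
    ≡⟨ length-++ (filter P? (map (inside ∷_) xs)) ⟩
  length (filter P? (map (inside ∷_) xs)) + length (filter P? (map (outside ∷_) xs))
    ≡⟨ cong₂ _+_ (count (inside ∷_)) (count (outside ∷_)) ⟩
  #subsets (p ∘ (inside ∷_)) + #subsets (p ∘ (outside ∷_))
    ∎
  where
  open ≡-Reasoning
  xs = allSubsets n
  P? = T? ∘ p
  count : (f : Subset n → Subset (suc n)) →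
          length (filter P? (map f xs)) ≡ length (filter (P? ∘ f) xs)
  count f = trans (cong length (filter-map P? f xs)) (length-map f (filter (P? ∘ f) xs))

#subsets-cong : {p q : Subset n → Bool} → (∀ S → T (p S) ⇔ T (q S)) → #subsets p ≡ #subsets q
#subsets-cong {n} p⇔q = cong length (filter-≐ (T? ∘ _) (T? ∘ _)
  ((λ {S} → Equivalence.to (p⇔q S)) , (λ {S} → Equivalence.from (p⇔q S))) (allSubsets n))

#subsets-false : ∀ n → #subsets {n} (λ _ → false) ≡ 0
#subsets-false zero    = refl
#subsets-false (suc n) =
  trans (#subsets-suc {n} (λ _ → false)) (cong₂ _+_ (#subsets-false n) (#subsets-false n))

isEmpty : Subset n → Bool
isEmpty []            = true
isEmpty (inside  ∷ S) = false
isEmpty (outside ∷ S) = isEmpty S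

atMostOne : Subset n → Bool
atMostOne []            = true
atMostOne (inside  ∷ S) = isEmpty S
atMostOne (outside ∷ S) = atMostOne S

AtMostOne : Subset n → Set
AtMostOne S = ∀ {u v} → u ∈ S → v ∈ S → u ≡ v

T-isEmpty⇔Empty : (S : Subset n) → T (isEmpty S) ⇔ Empty S
T-isEmpty⇔Empty S = mk⇔ (to S) (from S)
  where
  to : (S : Subset n) → T (isEmpty S) → Empty S
  to (outside ∷ S) t (suc u , there u∈) = to S t (u , u∈)

  from : (S : Subset n) → Empty S → T (isEmpty S)
  from []            _ = _
  from (inside  ∷ S) e = contradiction (zero , here) e
  from (outside ∷ S) e = from S (λ (u , u∈) → e (suc u , there u∈))

T-atMostOne⇔AtMostOne : (S : Subset n) → T (atMostOne S) ⇔ AtMostOne S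
T-atMostOne⇔AtMostOne S = mk⇔ (to S) (from S)
  where
  to : (S : Subset n) → T (atMostOne S) → AtMostOne S
  to (inside  ∷ S) t here       here       = refl
  to (inside  ∷ S) t here       (there v∈) = contradiction (_ , v∈) (Equivalence.to (T-isEmpty⇔Empty S) t)
  to (inside  ∷ S) t (there u∈) _          = contradiction (_ , u∈) (Equivalence.to (T-isEmpty⇔Empty S) t)
  to (outside ∷ S) t (there u∈) (there v∈) = cong suc (to S t u∈ v∈)

  from : (S : Subset n) → AtMostOne S → T (atMostOne S)
  from []            _   = _
  from (inside  ∷ S) amo =
    Equivalence.from (T-isEmpty⇔Empty S) (λ (_ , u∈) → 0≢1+n (amo here (there u∈)))
  from (outside ∷ S) amo = from S (λ u∈ v∈ → suc-injective (amo (there u∈) (there v∈)))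

#subsets-isEmpty : ∀ n → #subsets {n} isEmpty ≡ 1
#subsets-isEmpty zero    = refl
#subsets-isEmpty (suc n) =
  trans (#subsets-suc {n} isEmpty) (cong₂ _+_ (#subsets-false n) (#subsets-isEmpty n))

#subsets-atMostOne : ∀ n → #subsets {n} atMostOne ≡ suc n
#subsets-atMostOne zero    = refl
#subsets-atMostOne (suc n) =
  trans (#subsets-suc {n} atMostOne) (cong₂ _+_ (#subsets-isEmpty n) (#subsets-atMostOne n))

-- Adjacency uses `does` rather than `⌊_⌋` so that dec-true and dec-false rewrite it.
complete : ∀ n → SimpleGraph n
complete n = record
  { adj    = λ u v → not (does (u ≟ v))
  ; sym    = λ u v → cong not (does-≟-sym u v)
  ; irrefl = λ v → cong not (dec-true (v ≟ v) refl)
  }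
  where
  does-≟-sym : (u v : Fin n) → does (u ≟ v) ≡ does (v ≟ u)
  does-≟-sym u v with u ≟ v
  ... | yes refl = ≡-sym (dec-true (u ≟ u) refl)
  ... | no  u≢v  = ≡-sym (dec-false (v ≟ u) (u≢v ∘ ≡-sym))

complete-adjacent : {u v : Fin n} → u ≢ v → T (adj (complete n) u v)
complete-adjacent {u = u} {v} u≢v rewrite dec-false (u ≟ v) u≢v = _

complete-connected : ∀ n → Connected (complete (suc n))
complete-connected n = s≤s z≤n , walk
  where
  walk : ∀ u v → Walk (complete (suc n)) u v
  walk u v with u ≟ v
  ... | yes refl = here
  ... | no  u≢v  = step (complete-adjacent u≢v) here

Independent-complete⇔AtMostOne : (S : Subset n) → Independent (complete n) S ⇔ AtMostOne S
Independent-complete⇔AtMostOne {n} S = mk⇔ to from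
  where
  to : Independent (complete n) S → AtMostOne S
  to ind {u} {v} u∈ v∈ = decidable-stable (u ≟ v) (ind u∈ v∈ ∘ complete-adjacent)

  from : AtMostOne S → Independent (complete n) S
  from amo {u} u∈ v∈ with amo u∈ v∈
  ... | refl = ¬adjacent-self (complete n) u

#independentSets-complete : ∀ n → length (independentSets (complete n)) ≡ suc n
#independentSets-complete n = trans (#subsets-cong independent⇔atMostOne) (#subsets-atMostOne n)
  where
  independent⇔atMostOne : ∀ S → T (isIndependent (complete n) S) ⇔ T (atMostOne S)
  independent⇔atMostOne S = ⇔.trans (T-isIndependent⇔Independent (complete n) S)
    (⇔.trans (Independent-complete⇔AtMostOne S) (⇔.sym (T-atMostOne⇔AtMostOne S)))

theorem2p1 : (k : ℕ) → 1 < k →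
    Σ ℕ (λ n → Σ (SimpleGraph n) (λ G →
      Connected G × length (IkVertices (α G) G) ≡ k))
theorem2p1 (suc (suc m)) (s≤s (s≤s z≤n)) =
  suc m , K , complete-connected m ,
  trans (cong length (IkVertices-α≡independentSets K)) (#independentSets-complete (suc m))
  where K = complete (suc m)
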